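{- Let $T$ be an $\omega$-continuous strong monad and let $(\rho^{\mathsf v},\rho^{\mathsf c},\chi)$ be a strongly separated abstract higher-order GSOS law such that $\chi$ is $\omega$-continuous. Then $\hat\beta^\sharp\circ T\nabla^\sharp\circ(\rho^{\mathsf{cv}}_{\mu\Sigma,\mu\Sigma})^\sharp\circ\chi\circ\Sigma_{\mathsf c}(T\langle\iota^{\mathsf v},\gamma^{\mathsf v}\rangle\circ\hat\beta,\mathrm{id})\sqsubseteq\beta$ in $\mathcal C(S_{\mathsf c},TS_{\mathsf v})$.
   Context: Conventions: $\mathcal C$ is a distributive category; $\mathrm{inl},\mathrm{inr}$, $[f,g]$, $\langle f,g\rangle$, $\mathrm{fst},\mathrm{snd}$, $\nabla=[\mathrm{id},\mathrm{id}]$ as usual. Syntax: functors $\Sigma_{\mathsf v}\colon\mathcal C\to\mathcal C$, $\Sigma_{\mathsf c}\colon\mathcal C\times\mathcal C\to\mathcal C$, $\Sigma X=\Sigma_{\mathsf v}X+\Sigma_{\mathsf c}(X,X)$; free $\Sigma$-algebras exist; $(\Sigma^\star,\eta^\Sigma,\mu^\Sigma)$ is the free monad with algebra structures $\iota_X$; $\iota^{\mathsf v}=\iota\circ\mathrm{inl}$, $\iota^{\mathsf c}=\iota\circ\mathrm{inr}$. $\mu\Sigma=\Sigma^\star0$ with invertible $\iota\colon\Sigma\mu\Sigma\to\mu\Sigma$; $S_{\mathsf v}=\Sigma_{\mathsf v}\mu\Sigma$, $S_{\mathsf c}=\Sigma_{\mathsf c}(\mu\Sigma,\mu\Sigma)$,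 $\iota^{ -1}\colon\mu\Sigma\to S_{\mathsf v}+S_{\mathsf c}$; $\nabla^\sharp=\mu^\Sigma_0\circ\Sigma^\star\nabla\colon\Sigma^\star(\mu\Sigma+\mu\Sigma)\to\mu\Sigma$. Behaviour: $T$ a strong monad (unit $\eta^T$, multiplication $m^T$, strength $\tau$), $f^\sharp=m^T\circ Tf$, $f\boxplus g=[T\mathrm{inl}\circ f,T\mathrm{inr}\circ g]$; $D\colon\mathcal C^{op}\times\mathcal C\to\mathcal C$; $B(X,Y)=TD(X,Y)+TY$. Separated law $(\rho^{\mathsf v},\rho^{\mathsf c},\chi)$: $\rho^{\mathsf v}_X\colon\Sigma_{\mathsf v}X\to D(X,\Sigma^\star X)$ dinatural; $\rho^{\mathsf c}_{X,Y}\colon\Sigma_{\mathsf c}(X\times B(X,Y),X)\to T\Sigma^\star(X+Y)$ dinatural in $X$, natural in $Y$; $\chi_{X,Y}\colon\Sigma_{\mathsf c}(TX,Y)\to T\Sigma_{\mathsf c}(X,Y)$ natural, a distributive law of $T$ over each $\Sigma_{\mathsf c}(-,Y)$. $\rho^{\mathsf{cv}}=\rho^{\mathsf c}\circ\Sigma_{\mathsf c}(\mathrm{id}\times\mathrm{inl},\mathrm{id})$. Standing assumption: $\Theta\colon\mathcal C^3\to\mathcal C$, natural $\theta_{X,Y,Z}\colon\Theta(X,Y,Z)\to\Sigma_{\mathsf c}(X+Y,Z)$ with $\Sigma_{\mathsf c}(X,Z)\xrightarrow{\Sigma_{\mathsf c}(\mathrm{inl},\mathrm{id})}\Sigma_{\mathsf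 c}(X+Y,Z)\xleftarrow{\theta}\Theta(X,Y,Z)$ a coproduct naturally in $X,Y,Z$. Strongly separated: for all $X,Y$, with $\theta=\theta_{X\times TD(X,Y),X\times TY,X}$ and $\delta=[\mathrm{id}\times\mathrm{inl},\mathrm{id}\times\mathrm{inr}]$, $\rho^{\mathsf c}_{X,Y}\circ\Sigma_{\mathsf c}(\delta,\mathrm{id})\circ\theta=T(\iota^{\mathsf c}\circ\Sigma_{\mathsf c}(\eta^\Sigma,\eta^\Sigma))\circ\chi_{X+Y,X+Y}\circ\Sigma_{\mathsf c}((T\mathrm{fst}\circ\tau)\boxplus\mathrm{snd},\mathrm{inl})\circ\theta$. Operational model: $\gamma^{\mathsf v}=\eta^T\circ D(\mathrm{id},\mu^\Sigma_0)\circ\rho^{\mathsf v}_{\mu\Sigma}$; $\gamma^{\mathsf c}\colon S_{\mathsf c}\to T\mu\Sigma$ the unique morphism with $\gamma^{\mathsf c}\circ\Sigma_{\mathsf c}(\iota,\mathrm{id})=T\nabla^\sharp\circ\rho^{\mathsf c}_{\mu\Sigma,\mu\Sigma}\circ\Sigma_{\mathsf c}(\langle\iota,\gamma^{\mathsf v}+\gamma^{\mathsf c}\rangle,\mathrm{id})$. $\omega$-continuity: $T$ is $\omega$-continuous if each $\mathcal C(X,TY)$ is an $\omega$-cpo under $\sqsubseteq$ with least element $\bot$, Kleisli composition is $\omega$-continuous in each argument, strength and copairing preserve joins of chains ($\tau\circ(\mathrm{id}\times\bigsqcup f_i)=\bigsqcup\tau\circ(\mathrm{id}\times f_i)$, $[\bigsqcup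 f_i,\bigsqcup g_i]=\bigsqcup[f_i,g_i]$), $\tau\circ(\mathrm{id}\times\bot)=\bot$ and $f^\sharp\circ\bot=\bot$. $\chi$ is $\omega$-continuous if every $f\mapsto\chi\circ\Sigma_{\mathsf c}(f,\mathrm{id})$ is $\omega$-continuous. $\mu f.F(f)$ is the least fixpoint. $\beta=\mu f.\,[\eta^T,f]^\sharp\circ T\iota^{ -1}\circ\gamma^{\mathsf c}\colon S_{\mathsf c}\to TS_{\mathsf v}$, $\hat\beta=[\eta^T,\beta]\circ\iota^{ -1}\colon\mu\Sigma\to TS_{\mathsf v}$. -}

module Defs where

open import Level using (Level; _⊔_) renaming (suc to lsuc)
open import Relation.Binary.PropositionalEquality using (_≡_)
open import Data.Nat using (ℕ; suc)
open import Data.Product using (_×_; _,_)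

Chain : ∀ {a r} {A : Set a} → (A → A → Set r) → (ℕ → A) → Set r
Chain _⊑_ s = ∀ i → s i ⊑ s (suc i)

IsLub : ∀ {a r} {A : Set a} → (A → A → Set r) → (ℕ → A) → A → Set (a ⊔ r)
IsLub _⊑_ s x = (∀ i → s i ⊑ x) × (∀ y → (∀ i → s i ⊑ y) → x ⊑ y)

IsLeastFixpoint : ∀ {a r} {A : Set a} → (A → A → Set r) → (A → A) → A → Set (a ⊔ r)
IsLeastFixpoint _⊑_ F x = (F x ≡ x) × (∀ y → F y ≡ y → x ⊑ y)

record Category (o ℓ : Level) : Set (lsuc (o ⊔ ℓ)) where
  infixr 9 _∘_
  field
    Obj : Set o
    Hom : Obj → Obj → Set ℓ
    id  : ∀ {A} → Hom A A
    _∘_ : ∀ {A B C} → Hom B C → Hom A B → Hom A C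
    identityˡ : ∀ {A B} {f : Hom A B} → id ∘ f ≡ f
    identityʳ : ∀ {A B} {f : Hom A B} → f ∘ id ≡ f
    assoc : ∀ {A B C D} {f : Hom A B} {g : Hom B C} {h : Hom C D} →
            (h ∘ g) ∘ f ≡ h ∘ (g ∘ f)

record DistributiveCategory (o ℓ : Level) : Set (lsuc (o ⊔ ℓ)) where
  field
    category : Category o ℓ
  open Category category public
  infixr 7 _⊗_
  infixr 6 _⊕_
  field
    𝟙 : Obj
    ! : ∀ {A} → Hom A 𝟙
    !-unique : ∀ {A} (h : Hom A 𝟙) → h ≡ !
    _⊗_ : Obj → Obj → Obj
    fst : ∀ {A B} → Hom (A ⊗ B) A
    snd : ∀ {A B} → Hom (A ⊗ B) B
    ⟨_,_⟩ : ∀ {X A B} → Hom X A → Hom X B → Hom X (A ⊗ B)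
    fst-⟨⟩ : ∀ {X A B} {f : Hom X A} {g : Hom X B} → fst ∘ ⟨ f , g ⟩ ≡ f
    snd-⟨⟩ : ∀ {X A B} {f : Hom X A} {g : Hom X B} → snd ∘ ⟨ f , g ⟩ ≡ g
    ⟨⟩-unique : ∀ {X A B} {f : Hom X A} {g : Hom X B} (h : Hom X (A ⊗ B)) →
                fst ∘ h ≡ f → snd ∘ h ≡ g → h ≡ ⟨ f , g ⟩
    𝟘 : Obj
    ¡ : ∀ {A} → Hom 𝟘 A
    ¡-unique : ∀ {A} (h : Hom 𝟘 A) → h ≡ ¡
    _⊕_ : Obj → Obj → Obj
    inl : ∀ {A B} → Hom A (A ⊕ B)
    inr : ∀ {A B} → Hom B (A ⊕ B)
    [_,_] : ∀ {A B X} → Hom A X → Hom B X → Hom (A ⊕ B) X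
    []-inl : ∀ {A B X} {f : Hom A X} {g : Hom B X} → [ f , g ] ∘ inl ≡ f
    []-inr : ∀ {A B X} {f : Hom A X} {g : Hom B X} → [ f , g ] ∘ inr ≡ g
    []-unique : ∀ {A B X} {f : Hom A X} {g : Hom B X} (h : Hom (A ⊕ B) X) →
                h ∘ inl ≡ f → h ∘ inr ≡ g → h ≡ [ f , g ]
    distl : ∀ {A B C} → Hom (A ⊗ (B ⊕ C)) ((A ⊗ B) ⊕ (A ⊗ C))
    distl-inverseˡ : ∀ {A B C} →
      [ ⟨ fst , inl ∘ snd ⟩ , ⟨ fst , inr ∘ snd ⟩ ] ∘ distl {A} {B} {C} ≡ id
    distl-inverseʳ : ∀ {A B C} →
      distl {A} {B} {C} ∘ [ ⟨ fst , inl ∘ snd ⟩ , ⟨ fst , inr ∘ snd ⟩ ] ≡ id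
    annihil : ∀ {A} → Hom (A ⊗ 𝟘) 𝟘
    annihil-inverseˡ : ∀ {A} → ¡ ∘ annihil {A} ≡ id
    annihil-inverseʳ : ∀ {A} → annihil {A} ∘ ¡ ≡ id

  infixr 7 _⊗₁_
  infixr 6 _⊕₁_

  _⊗₁_ : ∀ {A A' B B'} → Hom A A' → Hom B B' → Hom (A ⊗ B) (A' ⊗ B')
  f ⊗₁ g = ⟨ f ∘ fst , g ∘ snd ⟩

  _⊕₁_ : ∀ {A A' B B'} → Hom A A' → Hom B B' → Hom (A ⊕ B) (A' ⊕ B')
  f ⊕₁ g = [ inl ∘ f , inr ∘ g ]

  ∇ : ∀ {A} → Hom (A ⊕ A) A
  ∇ = [ id , id ]

module Theory {o ℓ : Level} (C : DistributiveCategory o ℓ) where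
  open DistributiveCategory C

  record Endofunctor : Set (o ⊔ ℓ) where
    field
      F₀ : Obj → Obj
      F₁ : ∀ {A B} → Hom A B → Hom (F₀ A) (F₀ B)
      F-id : ∀ {A} → F₁ (id {A}) ≡ id
      F-∘ : ∀ {A B C} {f : Hom A B} {g : Hom B C} → F₁ (g ∘ f) ≡ F₁ g ∘ F₁ f

  record Bifunctor : Set (o ⊔ ℓ) where
    field
      F₀ : Obj → Obj → Obj
      F₁ : ∀ {A A' B B'} → Hom A A' → Hom B B' → Hom (F₀ A B) (F₀ A' B')
      F-id : ∀ {A B} → F₁ (id {A}) (id {B}) ≡ id
      F-∘ : ∀ {A A' A'' B B' B''} {f : Hom A A'} {f' : Hom A' A''}
              {g : Hom B B'} {g' : Hom B' B''} →
            F₁ (f' ∘ f) (g' ∘ g) ≡ F₁ f' g' ∘ F₁ f g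

  record MixedBifunctor : Set (o ⊔ ℓ) where
    field
      F₀ : Obj → Obj → Obj
      F₁ : ∀ {A A' B B'} → Hom A' A → Hom B B' → Hom (F₀ A B) (F₀ A' B')
      F-id : ∀ {A B} → F₁ (id {A}) (id {B}) ≡ id
      F-∘ : ∀ {A A' A'' B B' B''} {f : Hom A' A} {f' : Hom A'' A'}
              {g : Hom B B'} {g' : Hom B' B''} →
            F₁ (f ∘ f') (g' ∘ g) ≡ F₁ f' g' ∘ F₁ f g

  record Trifunctor : Set (o ⊔ ℓ) where
    field
      F₀ : Obj → Obj → Obj → Obj
      F₁ : ∀ {A A' B B' D D'} → Hom A A' → Hom B B' → Hom D D' →
           Hom (F₀ A B D) (F₀ A' B' D')
      F-id : ∀ {A B D} → F₁ (id {A}) (id {B}) (id {D}) ≡ id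
      F-∘ : ∀ {A A' A'' B B' B'' D D' D''} {f : Hom A A'} {f' : Hom A' A''}
              {g : Hom B B'} {g' : Hom B' B''} {h : Hom D D'} {h' : Hom D' D''} →
            F₁ (f' ∘ f) (g' ∘ g) (h' ∘ h) ≡ F₁ f' g' h' ∘ F₁ f g h

  record StrongMonad : Set (o ⊔ ℓ) where
    field
      T₀ : Obj → Obj
      T₁ : ∀ {A B} → Hom A B → Hom (T₀ A) (T₀ B)
      T-id : ∀ {A} → T₁ (id {A}) ≡ id
      T-∘ : ∀ {A B C} {f : Hom A B} {g : Hom B C} → T₁ (g ∘ f) ≡ T₁ g ∘ T₁ f
      ηT : ∀ {A} → Hom A (T₀ A)
      mT : ∀ {A} → Hom (T₀ (T₀ A)) (T₀ A)
      ηT-natural : ∀ {A B} (f : Hom A B) → T₁ f ∘ ηT ≡ ηT ∘ f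
      mT-natural : ∀ {A B} (f : Hom A B) → T₁ f ∘ mT ≡ mT ∘ T₁ (T₁ f)
      unitˡ : ∀ {A} → mT ∘ ηT {T₀ A} ≡ id
      unitʳ : ∀ {A} → mT ∘ T₁ (ηT {A}) ≡ id
      mT-assoc : ∀ {A} → mT ∘ T₁ (mT {A}) ≡ mT ∘ mT
      τ : ∀ {A B} → Hom (A ⊗ T₀ B) (T₀ (A ⊗ B))
      τ-natural : ∀ {A A' B B'} (f : Hom A A') (g : Hom B B') →
                  T₁ (f ⊗₁ g) ∘ τ ≡ τ ∘ (f ⊗₁ T₁ g)
      τ-unit : ∀ {B} → T₁ snd ∘ τ {𝟙} {B} ≡ snd
      τ-assoc : ∀ {A B D} →
        T₁ ⟨ fst ∘ fst , ⟨ snd ∘ fst , snd ⟩ ⟩ ∘ τ {A ⊗ B} {D}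
        ≡ τ ∘ (id ⊗₁ τ) ∘ ⟨ fst ∘ fst , ⟨ snd ∘ fst , snd ⟩ ⟩
      τ-η : ∀ {A B} → τ ∘ (id ⊗₁ ηT) ≡ ηT {A ⊗ B}
      τ-m : ∀ {A B} → τ ∘ (id ⊗₁ mT) ≡ mT ∘ T₁ τ ∘ τ {A} {T₀ B}

    infix 10 _♯
    _♯ : ∀ {A B} → Hom A (T₀ B) → Hom (T₀ A) (T₀ B)
    f ♯ = mT ∘ T₁ f

    infixr 6 _⊞_
    _⊞_ : ∀ {A B X Y} → Hom A (T₀ X) → Hom B (T₀ Y) → Hom (A ⊕ B) (T₀ (X ⊕ Y))
    f ⊞ g = [ T₁ inl ∘ f , T₁ inr ∘ g ]

  record OmegaContinuous (T : StrongMonad) (r : Level) : Set (o ⊔ ℓ ⊔ lsuc r) where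
    open StrongMonad T
    infix 4 _⊑_
    field
      _⊑_ : ∀ {X Y} → Hom X (T₀ Y) → Hom X (T₀ Y) → Set r
      ⊑-refl : ∀ {X Y} {f : Hom X (T₀ Y)} → f ⊑ f
      ⊑-trans : ∀ {X Y} {f g h : Hom X (T₀ Y)} → f ⊑ g → g ⊑ h → f ⊑ h
      ⊑-antisym : ∀ {X Y} {f g : Hom X (T₀ Y)} → f ⊑ g → g ⊑ f → f ≡ g
      ⊥ : ∀ {X Y} → Hom X (T₀ Y)
      ⊥-least : ∀ {X Y} (f : Hom X (T₀ Y)) → ⊥ ⊑ f
      ⨆ : ∀ {X Y} (s : ℕ → Hom X (T₀ Y)) → Chain _⊑_ s → Hom X (T₀ Y)
      ⨆-lub : ∀ {X Y} (s : ℕ → Hom X (T₀ Y)) (c : Chain _⊑_ s) → IsLub _⊑_ s (⨆ s c)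
      kleisli-contˡ : ∀ {X Y Z} (g : Hom Y (T₀ Z)) (s : ℕ → Hom X (T₀ Y)) (c : Chain _⊑_ s) →
                      IsLub _⊑_ (λ i → g ♯ ∘ s i) (g ♯ ∘ ⨆ s c)
      kleisli-contʳ : ∀ {X Y Z} (f : Hom X (T₀ Y)) (s : ℕ → Hom Y (T₀ Z)) (c : Chain _⊑_ s) →
                      IsLub _⊑_ (λ i → (s i) ♯ ∘ f) ((⨆ s c) ♯ ∘ f)
      strength-cont : ∀ {Z X Y} (s : ℕ → Hom X (T₀ Y)) (c : Chain _⊑_ s) →
                      IsLub _⊑_ (λ i → τ ∘ (id {Z} ⊗₁ s i)) (τ ∘ (id ⊗₁ ⨆ s c))
      copair-cont : ∀ {X Y Z} (s : ℕ → Hom X (T₀ Z)) (c : Chain _⊑_ s)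
                      (t : ℕ → Hom Y (T₀ Z)) (d : Chain _⊑_ t) →
                    IsLub _⊑_ (λ i → [ s i , t i ]) [ ⨆ s c , ⨆ t d ]
      strength-⊥ : ∀ {Z X Y} → τ ∘ (id {Z} ⊗₁ ⊥ {X} {Y}) ≡ ⊥
      kleisli-⊥ : ∀ {X Y Z} (f : Hom Y (T₀ Z)) → f ♯ ∘ ⊥ {X} ≡ ⊥

  module WithSig (Σv : Endofunctor) (Σc : Bifunctor) where

    Σv₀ : Obj → Obj
    Σv₀ = Endofunctor.F₀ Σv
    Σv₁ : ∀ {A B} → Hom A B → Hom (Σv₀ A) (Σv₀ B)
    Σv₁ = Endofunctor.F₁ Σv
    Σc₀ : Obj → Obj → Obj
    Σc₀ = Bifunctor.F₀ Σc
    Σc₁ : ∀ {A A' B B'} → Hom A A' → Hom B B' → Hom (Σc₀ A B) (Σc₀ A' B')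
    Σc₁ = Bifunctor.F₁ Σc

    Σ₀ : Obj → Obj
    Σ₀ X = Σv₀ X ⊕ Σc₀ X X
    Σ₁ : ∀ {A B} → Hom A B → Hom (Σ₀ A) (Σ₀ B)
    Σ₁ f = Σv₁ f ⊕₁ Σc₁ f f

    record FreeAlgebras : Set (o ⊔ ℓ) where
      field
        Free : Obj → Obj
        ηΣ : ∀ {X} → Hom X (Free X)
        ι : ∀ {X} → Hom (Σ₀ (Free X)) (Free X)
        ext : ∀ {X A} → Hom (Σ₀ A) A → Hom X A → Hom (Free X) A
        ext-η : ∀ {X A} {a : Hom (Σ₀ A) A} {f : Hom X A} → ext a f ∘ ηΣ ≡ f
        ext-ι : ∀ {X A} {a : Hom (Σ₀ A) A} {f : Hom X A} →
                ext a f ∘ ι ≡ a ∘ Σ₁ (ext a f)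
        ext-unique : ∀ {X A} {a : Hom (Σ₀ A) A} {f : Hom X A} (h : Hom (Free X) A) →
                     h ∘ ηΣ ≡ f → h ∘ ι ≡ a ∘ Σ₁ h → h ≡ ext a f

    -- Θ with θ : Θ(X,Y,Z) → Σc(X+Y,Z) such that
    -- Σc(X,Z) --Σc(inl,id)--> Σc(X+Y,Z) <--θ-- Θ(X,Y,Z) is a coproduct
    record ThetaDecomposition : Set (o ⊔ ℓ) where
      field
        Θ : Trifunctor
      Θ₀ : Obj → Obj → Obj → Obj
      Θ₀ = Trifunctor.F₀ Θ
      field
        θ : ∀ {X Y Z} → Hom (Θ₀ X Y Z) (Σc₀ (X ⊕ Y) Z)
        θ-natural : ∀ {X X' Y Y' Z Z'} (f : Hom X X') (g : Hom Y Y') (h : Hom Z Z') →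
                    Σc₁ (f ⊕₁ g) h ∘ θ ≡ θ ∘ Trifunctor.F₁ Θ f g h
        split : ∀ {X Y Z} → Hom (Σc₀ (X ⊕ Y) Z) (Σc₀ X Z ⊕ Θ₀ X Y Z)
        split-inverseˡ : ∀ {X Y Z} → [ Σc₁ inl id , θ ] ∘ split {X} {Y} {Z} ≡ id
        split-inverseʳ : ∀ {X Y Z} → split {X} {Y} {Z} ∘ [ Σc₁ inl id , θ ] ≡ id

    module WithFree (Fr : FreeAlgebras) (T : StrongMonad) (D : MixedBifunctor) where
      open FreeAlgebras Fr
      open StrongMonad T

      D₀ : Obj → Obj → Obj
      D₀ = MixedBifunctor.F₀ D
      D₁ : ∀ {A A' B B'} → Hom A' A → Hom B B' → Hom (D₀ A B) (D₀ A' B')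
      D₁ = MixedBifunctor.F₁ D

      Free₁ : ∀ {X Y} → Hom X Y → Hom (Free X) (Free Y)
      Free₁ f = ext ι (ηΣ ∘ f)

      μᶠ : ∀ {X} → Hom (Free (Free X)) (Free X)
      μᶠ = ext ι id

      μΣ : Obj
      μΣ = Free 𝟘

      Sv : Obj
      Sv = Σv₀ μΣ
      Sc : Obj
      Sc = Σc₀ μΣ μΣ

      -- inverse of ι : Σ μΣ → μΣ (Lambek)
      ι⁻¹ : Hom μΣ (Sv ⊕ Sc)
      ι⁻¹ = ext (Σ₁ ι) ¡

      ιv : ∀ {X} → Hom (Σv₀ (Free X)) (Free X)
      ιv = ι ∘ inl
      ιc : ∀ {X} → Hom (Σc₀ (Free X) (Free X)) (Free X)
      ιc = ι ∘ inr

      ∇♯ : Hom (Free (μΣ ⊕ μΣ)) μΣ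
      ∇♯ = μᶠ ∘ Free₁ ∇

      B₀ : Obj → Obj → Obj
      B₀ X Y = T₀ (D₀ X Y) ⊕ T₀ Y

      record SeparatedLaw : Set (o ⊔ ℓ) where
        field
          ρv : ∀ {X} → Hom (Σv₀ X) (D₀ X (Free X))
          ρv-dinatural : ∀ {X Y} (f : Hom X Y) →
            D₁ id (Free₁ f) ∘ ρv {X} ≡ D₁ f id ∘ ρv {Y} ∘ Σv₁ f
          ρc : ∀ {X Y} → Hom (Σc₀ (X ⊗ B₀ X Y) X) (T₀ (Free (X ⊕ Y)))
          ρc-dinatural : ∀ {X X' Y} (f : Hom X X') →
            T₁ (Free₁ (f ⊕₁ id)) ∘ ρc {X} {Y} ∘ Σc₁ (id ⊗₁ (T₁ (D₁ f id) ⊕₁ id)) id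
            ≡ ρc {X'} {Y} ∘ Σc₁ (f ⊗₁ id) f
          ρc-natural : ∀ {X Y Y'} (g : Hom Y Y') →
            T₁ (Free₁ (id ⊕₁ g)) ∘ ρc {X} {Y}
            ≡ ρc {X} {Y'} ∘ Σc₁ (id ⊗₁ (T₁ (D₁ id g) ⊕₁ T₁ g)) id
          χ : ∀ {X Y} → Hom (Σc₀ (T₀ X) Y) (T₀ (Σc₀ X Y))
          χ-natural : ∀ {X X' Y Y'} (f : Hom X X') (g : Hom Y Y') →
            T₁ (Σc₁ f g) ∘ χ ≡ χ ∘ Σc₁ (T₁ f) g
          χ-η : ∀ {X Y} → χ {X} {Y} ∘ Σc₁ ηT id ≡ ηT
          χ-m : ∀ {X Y} → χ {X} {Y} ∘ Σc₁ mT id ≡ mT ∘ T₁ χ ∘ χ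

      module WithLaw (L : SeparatedLaw) where
        open SeparatedLaw L

        ρcv : ∀ {X Y} → Hom (Σc₀ (X ⊗ T₀ (D₀ X Y)) X) (T₀ (Free (X ⊕ Y)))
        ρcv = ρc ∘ Σc₁ (id ⊗₁ inl) id

        StronglySeparated : ThetaDecomposition → Set (o ⊔ ℓ)
        StronglySeparated Θd = ∀ {X Y} →
            ρc {X} {Y} ∘ Σc₁ [ id ⊗₁ inl , id ⊗₁ inr ] id
              ∘ θ {X ⊗ T₀ (D₀ X Y)} {X ⊗ T₀ Y} {X}
            ≡ T₁ (ιc ∘ Σc₁ ηΣ ηΣ) ∘ χ {X ⊕ Y} {X ⊕ Y}
              ∘ Σc₁ ((T₁ fst ∘ τ) ⊞ snd) inl ∘ θ {X ⊗ T₀ (D₀ X Y)} {X ⊗ T₀ Y} {X}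
          where open ThetaDecomposition Θd

        χ-ωContinuous : ∀ {r} → OmegaContinuous T r → Set (o ⊔ ℓ ⊔ r)
        χ-ωContinuous ω = ∀ {A X Y} (s : ℕ → Hom A (T₀ X)) (c : Chain _⊑_ s) →
            IsLub _⊑_ (λ i → χ {X} {Y} ∘ Σc₁ (s i) id) (χ ∘ Σc₁ (⨆ s c) id)
          where open OmegaContinuous ω

        γv : Hom Sv (T₀ (D₀ μΣ μΣ))
        γv = ηT ∘ D₁ id μᶠ ∘ ρv {μΣ}

        IsGammaC : Hom Sc (T₀ μΣ) → Set ℓ
        IsGammaC γc =
          γc ∘ Σc₁ ι id ≡ T₁ ∇♯ ∘ ρc {μΣ} {μΣ} ∘ Σc₁ ⟨ ι , γv ⊕₁ γc ⟩ id

        -- the functional whose least fixpoint is β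
        Φ : Hom Sc (T₀ μΣ) → Hom Sc (T₀ Sv) → Hom Sc (T₀ Sv)
        Φ γc f = [ ηT , f ] ♯ ∘ T₁ ι⁻¹ ∘ γc

        βhat : Hom Sc (T₀ Sv) → Hom μΣ (T₀ Sv)
        βhat β = [ ηT , β ] ∘ ι⁻¹

module Submission where

-- β is the join of its Kleene approximants βₙ = Φⁿ ⊥, and the left-hand side equals Ψ β̂ for the
-- ω-continuous map Ψ x = β♯ ∘ χ ∘ Σc(T ιv ∘ x, id), so it suffices to show Ψ β̂ₙ ⊑ β for every n.
-- Via μΣ ≅ Sv + Sc and the decomposition Θ, Sc splits into Σc(Sv, μΣ) and Θ(Sv, Sc, μΣ). On the
-- first summand both sides coincide because variables are stuck; on the second, strong separation
-- rewrites β as β♯ ∘ χ ∘ Σc(step, id), and Ψ β̂ₙ₊₁ is bounded there by Kleisli-extending the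
-- bound Ψ β̂ₙ ⊑ β along step.

open import Level using (Level; _⊔_)
open import Relation.Binary.PropositionalEquality
  using (_≡_; refl; sym; trans; cong; cong₂; subst; subst₂; module ≡-Reasoning)
open import Data.Nat using (ℕ; zero; suc)
open import Data.Nat.GeneralisedArithmetic using (fold)
open import Data.Product using (_,_; proj₁; proj₂)
open import Defs

module DistributiveCategoryProperties {o ℓ} (C : DistributiveCategory o ℓ) where
  open DistributiveCategory C

  ∘-[] : ∀ {A B X Y} {f : Hom A X} {g : Hom B X} {h : Hom X Y} →
         h ∘ [ f , g ] ≡ [ h ∘ f , h ∘ g ]
  ∘-[] {f = f} {g} {h} =
    []-unique (h ∘ [ f , g ]) (trans assoc (cong (h ∘_) []-inl)) (trans assoc (cong (h ∘_) []-inr))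

  []-η : ∀ {A B} → [ inl , inr ] ≡ id {A ⊕ B}
  []-η = sym ([]-unique id identityˡ identityˡ)

  []∘⊕₁ : ∀ {A A' B B' X} {f : Hom A A'} {g : Hom B B'} {h : Hom A' X} {k : Hom B' X} →
          [ h , k ] ∘ (f ⊕₁ g) ≡ [ h ∘ f , k ∘ g ]
  []∘⊕₁ {f = f} {g} = trans ∘-[]
    (cong₂ [_,_] (trans (sym assoc) (cong (_∘ f) []-inl)) (trans (sym assoc) (cong (_∘ g) []-inr)))

  ⟨⟩∘ : ∀ {X Y A B} {f : Hom X A} {g : Hom X B} {h : Hom Y X} → ⟨ f , g ⟩ ∘ h ≡ ⟨ f ∘ h , g ∘ h ⟩
  ⟨⟩∘ {f = f} {g} {h} = ⟨⟩-unique (⟨ f , g ⟩ ∘ h)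
    (trans (sym assoc) (cong (_∘ h) fst-⟨⟩)) (trans (sym assoc) (cong (_∘ h) snd-⟨⟩))

  ⊗₁∘⟨⟩ : ∀ {X A A' B B'} {a : Hom A A'} {b : Hom B B'} {f : Hom X A} {g : Hom X B} →
          (a ⊗₁ b) ∘ ⟨ f , g ⟩ ≡ ⟨ a ∘ f , b ∘ g ⟩
  ⊗₁∘⟨⟩ {a = a} {b} = trans ⟨⟩∘
    (cong₂ ⟨_,_⟩ (trans assoc (cong (a ∘_) fst-⟨⟩)) (trans assoc (cong (b ∘_) snd-⟨⟩)))

  ⟨id,⟩∘ : ∀ {X A B B'} {b : Hom B B'} {f : Hom X A} {g : Hom X B} →
           ⟨ f , b ∘ g ⟩ ≡ (id ⊗₁ b) ∘ ⟨ f , g ⟩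
  ⟨id,⟩∘ = trans (cong₂ ⟨_,_⟩ (sym identityˡ) refl) (sym ⊗₁∘⟨⟩)

module StrongMonadProperties {o ℓ} (C : DistributiveCategory o ℓ) (T : Theory.StrongMonad C) where
  open DistributiveCategory C
  open Theory.StrongMonad T
  open ≡-Reasoning

  T₁-retract : ∀ {A B X} {s : Hom A B} {r : Hom B A} {x : Hom X (T₀ A)} →
               r ∘ s ≡ id → T₁ r ∘ T₁ s ∘ x ≡ x
  T₁-retract {s = s} {r} {x} r∘s≡id = begin
    T₁ r ∘ T₁ s ∘ x   ≡⟨ sym assoc ⟩
    (T₁ r ∘ T₁ s) ∘ x ≡⟨ cong (_∘ x) (sym T-∘) ⟩
    T₁ (r ∘ s) ∘ x    ≡⟨ cong (λ h → T₁ h ∘ x) r∘s≡id ⟩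
    T₁ id ∘ x         ≡⟨ cong (_∘ x) T-id ⟩
    id ∘ x            ≡⟨ identityˡ ⟩
    x                 ∎

  ♯∘T₁ : ∀ {A B X} {f : Hom B (T₀ X)} {g : Hom A B} → f ♯ ∘ T₁ g ≡ (f ∘ g) ♯
  ♯∘T₁ = trans assoc (cong (mT ∘_) (sym T-∘))

  T₁∘♯ : ∀ {A B X} {f : Hom A (T₀ B)} {g : Hom B X} → T₁ g ∘ f ♯ ≡ (T₁ g ∘ f) ♯
  T₁∘♯ {f = f} {g} = begin
    T₁ g ∘ mT ∘ T₁ f         ≡⟨ sym assoc ⟩
    (T₁ g ∘ mT) ∘ T₁ f       ≡⟨ cong (_∘ T₁ f) (mT-natural g) ⟩
    (mT ∘ T₁ (T₁ g)) ∘ T₁ f  ≡⟨ assoc ⟩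
    mT ∘ T₁ (T₁ g) ∘ T₁ f    ≡⟨ cong (mT ∘_) (sym T-∘) ⟩
    mT ∘ T₁ (T₁ g ∘ f)       ∎

  ♯∘♯ : ∀ {A B X} {f : Hom A (T₀ B)} {g : Hom B (T₀ X)} → g ♯ ∘ f ♯ ≡ (g ♯ ∘ f) ♯
  ♯∘♯ {f = f} {g} = begin
    (mT ∘ T₁ g) ∘ f ♯          ≡⟨ assoc ⟩
    mT ∘ T₁ g ∘ f ♯            ≡⟨ cong (mT ∘_) T₁∘♯ ⟩
    mT ∘ mT ∘ T₁ (T₁ g ∘ f)    ≡⟨ sym assoc ⟩
    (mT ∘ mT) ∘ T₁ (T₁ g ∘ f)  ≡⟨ cong (_∘ T₁ (T₁ g ∘ f)) (sym mT-assoc) ⟩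
    (mT ∘ T₁ mT) ∘ T₁ (T₁ g ∘ f) ≡⟨ assoc ⟩
    mT ∘ T₁ mT ∘ T₁ (T₁ g ∘ f) ≡⟨ cong (mT ∘_) (sym T-∘) ⟩
    mT ∘ T₁ (mT ∘ T₁ g ∘ f)    ≡⟨ cong (λ h → mT ∘ T₁ h) (sym assoc) ⟩
    (g ♯ ∘ f) ♯                ∎

  ♯∘ηT : ∀ {A X} {f : Hom A (T₀ X)} → f ♯ ∘ ηT ≡ f
  ♯∘ηT {f = f} = begin
    (mT ∘ T₁ f) ∘ ηT ≡⟨ assoc ⟩
    mT ∘ T₁ f ∘ ηT   ≡⟨ cong (mT ∘_) (ηT-natural f) ⟩
    mT ∘ ηT ∘ f      ≡⟨ sym assoc ⟩
    (mT ∘ ηT) ∘ f    ≡⟨ cong (_∘ f) unitˡ ⟩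
    id ∘ f           ≡⟨ identityˡ ⟩
    f                ∎

  ♯∘ηT∘ : ∀ {A B X} {f : Hom B (T₀ X)} {g : Hom A B} → f ♯ ∘ ηT ∘ g ≡ f ∘ g
  ♯∘ηT∘ {g = g} = trans (sym assoc) (cong (_∘ g) ♯∘ηT)

  T₁-as-♯ : ∀ {A B} {g : Hom A B} → T₁ g ≡ (ηT ∘ g) ♯
  T₁-as-♯ {g = g} = sym (begin
    mT ∘ T₁ (ηT ∘ g)    ≡⟨ cong (mT ∘_) T-∘ ⟩
    mT ∘ T₁ ηT ∘ T₁ g   ≡⟨ sym assoc ⟩
    (mT ∘ T₁ ηT) ∘ T₁ g ≡⟨ cong (_∘ T₁ g) unitʳ ⟩
    id ∘ T₁ g           ≡⟨ identityˡ ⟩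
    T₁ g                ∎)

module OmegaContinuity {o ℓ r} (C : DistributiveCategory o ℓ) (T : Theory.StrongMonad C)
                       (ω : Theory.OmegaContinuous C T r) where
  open DistributiveCategory C
  open Theory.StrongMonad T
  open Theory.OmegaContinuous ω
  open StrongMonadProperties C T

  ≡⇒⊑ : ∀ {X Y} {f g : Hom X (T₀ Y)} → f ≡ g → f ⊑ g
  ≡⇒⊑ refl = ⊑-refl

  IsLub-unique : ∀ {X Y} {s : ℕ → Hom X (T₀ Y)} {x y} → IsLub _⊑_ s x → IsLub _⊑_ s y → x ≡ y
  IsLub-unique (x-ub , x-least) (y-ub , y-least) = ⊑-antisym (x-least _ y-ub) (y-least _ x-ub)

  IsLub-resp : ∀ {X Y} {s t : ℕ → Hom X (T₀ Y)} {x y} →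
               (∀ i → s i ≡ t i) → x ≡ y → IsLub _⊑_ s x → IsLub _⊑_ t y
  IsLub-resp s≡t refl (ub , least) =
    (λ i → subst (_⊑ _) (s≡t i) (ub i)) , (λ z t⊑z → least z (λ i → subst (_⊑ z) (sym (s≡t i)) (t⊑z i)))

  const-isLub : ∀ {X Y} (a : Hom X (T₀ Y)) → IsLub _⊑_ (λ _ → a) a
  const-isLub a = (λ _ → ⊑-refl) , (λ y a⊑y → a⊑y 0)

  record Continuous {A X B Y} (F : Hom A (T₀ X) → Hom B (T₀ Y)) : Set (ℓ ⊔ r) where
    constructor continuous
    field preserves-⨆ : ∀ s (c : Chain _⊑_ s) → IsLub _⊑_ (λ i → F (s i)) (F (⨆ s c))
  open Continuous

  -- Monotonicity is continuity on the chain  a ⊑ b ⊑ b ⊑ …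
  continuous⇒monotone : ∀ {A X B Y} {F : Hom A (T₀ X) → Hom B (T₀ Y)} →
                        Continuous F → ∀ {a b} → a ⊑ b → F a ⊑ F b
  continuous⇒monotone {F = F} F-cont {a} {b} a⊑b =
    subst (λ z → F a ⊑ F z) (IsLub-unique (⨆-lub s s-chain) s-isLub) (proj₁ (preserves-⨆ F-cont s s-chain) 0)
    where
    s : ℕ → _
    s zero    = a
    s (suc _) = b
    s-chain : Chain _⊑_ s
    s-chain zero    = a⊑b
    s-chain (suc _) = ⊑-refl
    s-isLub : IsLub _⊑_ s b
    s-isLub = (λ { zero → a⊑b ; (suc _) → ⊑-refl }) , (λ y s⊑y → s⊑y 1)

  continuous-preserves-lub : ∀ {A X B Y} {F : Hom A (T₀ X) → Hom B (T₀ Y)} → Continuous F →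
                             ∀ {s x} → Chain _⊑_ s → IsLub _⊑_ s x → IsLub _⊑_ (λ i → F (s i)) (F x)
  continuous-preserves-lub {F = F} F-cont {s} c s-isLub =
    subst (λ z → IsLub _⊑_ (λ i → F (s i)) (F z)) (IsLub-unique (⨆-lub s c) s-isLub) (preserves-⨆ F-cont s c)

  continuous-∘ : ∀ {A X B Y E Z} {F : Hom B (T₀ Y) → Hom E (T₀ Z)} {G : Hom A (T₀ X) → Hom B (T₀ Y)} →
                 Continuous F → Continuous G → Continuous (λ x → F (G x))
  continuous-∘ F-cont G-cont = continuous λ s c →
    continuous-preserves-lub F-cont (λ i → continuous⇒monotone G-cont (c i)) (preserves-⨆ G-cont s c)

  continuous-resp : ∀ {A X B Y} {F G : Hom A (T₀ X) → Hom B (T₀ Y)} →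
                    (∀ x → F x ≡ G x) → Continuous G → Continuous F
  continuous-resp F≡G G-cont = continuous λ s c →
    IsLub-resp (λ i → sym (F≡G (s i))) (sym (F≡G (⨆ s c))) (preserves-⨆ G-cont s c)

  ♯∘-continuous : ∀ {A X Y} (h : Hom X (T₀ Y)) → Continuous {A} (λ x → h ♯ ∘ x)
  ♯∘-continuous h = continuous (kleisli-contˡ h)

  -♯∘-continuous : ∀ {A X Y} (k : Hom A (T₀ X)) → Continuous {X} {Y} (λ x → x ♯ ∘ k)
  -♯∘-continuous k = continuous (kleisli-contʳ k)

  ∘-continuous : ∀ {A X Y} (k : Hom A X) → Continuous {X} {Y} (λ x → x ∘ k)
  ∘-continuous k = continuous-resp (λ x → sym ♯∘ηT∘) (-♯∘-continuous (ηT ∘ k))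

  T₁∘-continuous : ∀ {A X Y} (g : Hom X Y) → Continuous {A} (λ x → T₁ g ∘ x)
  T₁∘-continuous g = continuous-resp (λ x → cong (_∘ x) T₁-as-♯) (♯∘-continuous (ηT ∘ g))

  [_,-]-continuous : ∀ {A B Y} (a : Hom A (T₀ Y)) → Continuous {B} (λ x → [ a , x ])
  [ a ,-]-continuous = continuous λ s c →
    IsLub-resp (λ _ → refl) (cong [_, ⨆ s c ] (IsLub-unique (⨆-lub _ _) (const-isLub a)))
      (copair-cont (λ _ → a) (λ _ → ⊑-refl) s c)

  [-,_]-continuous : ∀ {A B Y} (b : Hom B (T₀ Y)) → Continuous {A} (λ x → [ x , b ])
  [-, b ]-continuous = continuous λ s c →
    IsLub-resp (λ _ → refl) (cong [ ⨆ s c ,_] (IsLub-unique (⨆-lub _ _) (const-isLub b)))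
      (copair-cont s c (λ _ → b) (λ _ → ⊑-refl))

  []-monotone : ∀ {A B Y} {a a' : Hom A (T₀ Y)} {b b' : Hom B (T₀ Y)} →
                a ⊑ a' → b ⊑ b' → [ a , b ] ⊑ [ a' , b' ]
  []-monotone {a' = a'} {b = b} a⊑a' b⊑b' =
    ⊑-trans (continuous⇒monotone [-, b ]-continuous a⊑a') (continuous⇒monotone [ a' ,-]-continuous b⊑b')

  ⊑-reflect-retraction : ∀ {A B Y} {f g : Hom B (T₀ Y)} (s : Hom A B) (r : Hom B A) →
                         s ∘ r ≡ id → f ∘ s ⊑ g ∘ s → f ⊑ g
  ⊑-reflect-retraction {f = f} {g} s r s∘r≡id f∘s⊑g∘s =
    subst₂ _⊑_ (factor f) (factor g) (continuous⇒monotone (∘-continuous r) f∘s⊑g∘s)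
    where
    factor : ∀ h → (h ∘ s) ∘ r ≡ h
    factor h = trans assoc (trans (cong (h ∘_) s∘r≡id) identityʳ)

  module Kleene {A X} {F : Hom A (T₀ X) → Hom A (T₀ X)} (F-cont : Continuous F) where

    kleene-chain : Chain _⊑_ (fold ⊥ F)
    kleene-chain zero    = ⊥-least _
    kleene-chain (suc n) = continuous⇒monotone F-cont (kleene-chain n)

    leastFixpoint-isLub : ∀ {β} → IsLeastFixpoint _⊑_ F β → IsLub _⊑_ (fold ⊥ F) β
    leastFixpoint-isLub {β} (Fβ≡β , β-least) = below-β , λ y ub → ⊑-trans (β-least k Fk≡k) (k-least y ub)
      where
      below-β : ∀ n → fold ⊥ F n ⊑ β
      below-β zero    = ⊥-least _
      below-β (suc n) = subst (F (fold ⊥ F n) ⊑_) Fβ≡β (continuous⇒monotone F-cont (below-β n))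
      k = ⨆ (fold ⊥ F) kleene-chain
      k-ub = proj₁ (⨆-lub _ kleene-chain)
      k-least = proj₂ (⨆-lub _ kleene-chain)
      Fk≡k : F k ≡ k
      Fk≡k = ⊑-antisym (proj₂ (preserves-⨆ F-cont _ kleene-chain) k (λ i → k-ub (suc i)))
                       (k-least (F k) (λ i → ⊑-trans (kleene-chain i) (proj₁ (preserves-⨆ F-cont _ kleene-chain) i)))

module SignatureProperties {o ℓ} (C : DistributiveCategory o ℓ)
                           (Σv : Theory.Endofunctor C) (Σc : Theory.Bifunctor C) where
  open DistributiveCategory C
  open Theory C
  open WithSig Σv Σc
  open DistributiveCategoryProperties C

  Σc₁-∘ˡ : ∀ {A A' A'' B} {f : Hom A A'} {g : Hom A' A''} → Σc₁ (g ∘ f) (id {B}) ≡ Σc₁ g id ∘ Σc₁ f id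
  Σc₁-∘ˡ {f = f} {g} = trans (cong (Σc₁ (g ∘ f)) (sym identityˡ)) (Bifunctor.F-∘ Σc)

  Σ₁-id : ∀ {A} → Σ₁ (id {A}) ≡ id
  Σ₁-id = trans (cong₂ [_,_] (trans (cong (inl ∘_) (Endofunctor.F-id Σv)) identityʳ)
                             (trans (cong (inr ∘_) (Bifunctor.F-id Σc)) identityʳ))
                []-η

  Σ₁-∘ : ∀ {A A' A''} {f : Hom A A'} {g : Hom A' A''} → Σ₁ (g ∘ f) ≡ Σ₁ g ∘ Σ₁ f
  Σ₁-∘ {f = f} {g} = sym (trans []∘⊕₁ (cong₂ [_,_]
    (trans assoc (cong (inl ∘_) (sym (Endofunctor.F-∘ Σv))))
    (trans assoc (cong (inr ∘_) (sym (Bifunctor.F-∘ Σc))))))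

module InitialAlgebraProperties {o ℓ} (C : DistributiveCategory o ℓ)
                                (Σv : Theory.Endofunctor C) (Σc : Theory.Bifunctor C)
                                (Fr : Theory.WithSig.FreeAlgebras C Σv Σc)
                                (T : Theory.StrongMonad C) (D : Theory.MixedBifunctor C) where
  open DistributiveCategory C
  open Theory C
  open WithSig Σv Σc
  open FreeAlgebras Fr
  open WithFree Fr T D
  open SignatureProperties C Σv Σc
  open ≡-Reasoning

  -- Lambek: ι ∘ ι⁻¹ is an algebra endomorphism of the initial algebra, hence the identity.
  ι∘ι⁻¹ : ι ∘ ι⁻¹ ≡ id
  ι∘ι⁻¹ = trans (ext-unique (ι ∘ ι⁻¹) (¡-unique _) homomorphism)
                (sym (ext-unique id (¡-unique _) (trans identityˡ (trans (sym identityʳ) (cong (ι ∘_) (sym Σ₁-id))))))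
    where
    homomorphism : (ι ∘ ι⁻¹) ∘ ι ≡ ι ∘ Σ₁ (ι ∘ ι⁻¹)
    homomorphism = begin
      (ι ∘ ι⁻¹) ∘ ι       ≡⟨ assoc ⟩
      ι ∘ ι⁻¹ ∘ ι         ≡⟨ cong (ι ∘_) ext-ι ⟩
      ι ∘ Σ₁ ι ∘ Σ₁ ι⁻¹   ≡⟨ cong (ι ∘_) (sym Σ₁-∘) ⟩
      ι ∘ Σ₁ (ι ∘ ι⁻¹)    ∎

  ι⁻¹∘ι : ι⁻¹ ∘ ι ≡ id
  ι⁻¹∘ι = trans ext-ι (trans (sym Σ₁-∘) (trans (cong Σ₁ ι∘ι⁻¹) Σ₁-id))

  ∘ι⁻¹∘ι : ∀ {A B} {f : Hom (Sv ⊕ Sc) B} {g : Hom A (Sv ⊕ Sc)} → (f ∘ ι⁻¹) ∘ ι ∘ g ≡ f ∘ g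
  ∘ι⁻¹∘ι {f = f} {g} = trans assoc (cong (f ∘_) (trans (sym assoc) (trans (cong (_∘ g) ι⁻¹∘ι) identityˡ)))

  ∇♯∘ηΣ : ∇♯ ∘ ηΣ ≡ ∇
  ∇♯∘ηΣ = trans assoc (trans (cong (μᶠ ∘_) ext-η) (trans (sym assoc) (trans (cong (_∘ ∇) ext-η) identityˡ)))

  ∇♯∘ι : ∇♯ ∘ ι ≡ ι ∘ Σ₁ ∇♯
  ∇♯∘ι = begin
    (μᶠ ∘ Free₁ ∇) ∘ ι          ≡⟨ assoc ⟩
    μᶠ ∘ Free₁ ∇ ∘ ι            ≡⟨ cong (μᶠ ∘_) ext-ι ⟩
    μᶠ ∘ ι ∘ Σ₁ (Free₁ ∇)       ≡⟨ sym assoc ⟩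
    (μᶠ ∘ ι) ∘ Σ₁ (Free₁ ∇)     ≡⟨ cong (_∘ Σ₁ (Free₁ ∇)) ext-ι ⟩
    (ι ∘ Σ₁ μᶠ) ∘ Σ₁ (Free₁ ∇)  ≡⟨ assoc ⟩
    ι ∘ Σ₁ μᶠ ∘ Σ₁ (Free₁ ∇)    ≡⟨ cong (ι ∘_) (sym Σ₁-∘) ⟩
    ι ∘ Σ₁ ∇♯                   ∎

  ∇♯∘ιc∘ηΣ : ∇♯ ∘ ιc ∘ Σc₁ ηΣ ηΣ ≡ ι ∘ inr ∘ Σc₁ ∇ ∇
  ∇♯∘ιc∘ηΣ = begin
    ∇♯ ∘ (ι ∘ inr) ∘ Σc₁ ηΣ ηΣ        ≡⟨ trans (sym assoc) (cong (_∘ Σc₁ ηΣ ηΣ) (sym assoc)) ⟩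
    ((∇♯ ∘ ι) ∘ inr) ∘ Σc₁ ηΣ ηΣ      ≡⟨ cong (λ h → (h ∘ inr) ∘ Σc₁ ηΣ ηΣ) ∇♯∘ι ⟩
    ((ι ∘ Σ₁ ∇♯) ∘ inr) ∘ Σc₁ ηΣ ηΣ   ≡⟨ cong (_∘ Σc₁ ηΣ ηΣ) (trans assoc (cong (ι ∘_) []-inr)) ⟩
    (ι ∘ inr ∘ Σc₁ ∇♯ ∇♯) ∘ Σc₁ ηΣ ηΣ ≡⟨ trans assoc (cong (ι ∘_) assoc) ⟩
    ι ∘ inr ∘ Σc₁ ∇♯ ∇♯ ∘ Σc₁ ηΣ ηΣ   ≡⟨ cong (λ h → ι ∘ inr ∘ h) (sym (Bifunctor.F-∘ Σc)) ⟩
    ι ∘ inr ∘ Σc₁ (∇♯ ∘ ηΣ) (∇♯ ∘ ηΣ) ≡⟨ cong (λ h → ι ∘ inr ∘ Σc₁ h h) ∇♯∘ηΣ ⟩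
    ι ∘ inr ∘ Σc₁ ∇ ∇                 ∎

module DistributiveLawProperties {o ℓ} (C : DistributiveCategory o ℓ)
                                 (Σv : Theory.Endofunctor C) (Σc : Theory.Bifunctor C)
                                 (Fr : Theory.WithSig.FreeAlgebras C Σv Σc)
                                 (T : Theory.StrongMonad C) (D : Theory.MixedBifunctor C)
                                 (L : Theory.WithSig.WithFree.SeparatedLaw C Σv Σc Fr T D) where
  open DistributiveCategory C
  open Theory C
  open StrongMonad T
  open WithSig Σv Σc
  open WithFree Fr T D
  open SeparatedLaw L
  open SignatureProperties C Σv Σc
  open ≡-Reasoning

  χ∘Σc₁-T₁ : ∀ {A X X' Y} {g : Hom X X'} {h : Hom A (T₀ X)} →
             χ {X'} {Y} ∘ Σc₁ (T₁ g ∘ h) id ≡ T₁ (Σc₁ g id) ∘ χ ∘ Σc₁ h id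
  χ∘Σc₁-T₁ {g = g} {h} = begin
    χ ∘ Σc₁ (T₁ g ∘ h) id              ≡⟨ cong (χ ∘_) Σc₁-∘ˡ ⟩
    χ ∘ Σc₁ (T₁ g) id ∘ Σc₁ h id       ≡⟨ sym assoc ⟩
    (χ ∘ Σc₁ (T₁ g) id) ∘ Σc₁ h id     ≡⟨ cong (_∘ Σc₁ h id) (sym (χ-natural g id)) ⟩
    (T₁ (Σc₁ g id) ∘ χ) ∘ Σc₁ h id     ≡⟨ assoc ⟩
    T₁ (Σc₁ g id) ∘ χ ∘ Σc₁ h id       ∎

  χ∘Σc₁-ηT : ∀ {A X Y} {g : Hom A X} → χ {X} {Y} ∘ Σc₁ (ηT ∘ g) id ≡ ηT ∘ Σc₁ g id
  χ∘Σc₁-ηT {g = g} = trans (cong (χ ∘_) Σc₁-∘ˡ) (trans (sym assoc) (cong (_∘ Σc₁ g id) χ-η))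

  χ∘Σc₁-♯ : ∀ {A X Y Z} {y : Hom X (T₀ Y)} {g : Hom A (T₀ X)} →
            χ {Y} {Z} ∘ Σc₁ (y ♯ ∘ g) id ≡ (χ ∘ Σc₁ y id) ♯ ∘ χ ∘ Σc₁ g id
  χ∘Σc₁-♯ {y = y} {g} = begin
    χ ∘ Σc₁ ((mT ∘ T₁ y) ∘ g) id                 ≡⟨ cong (χ ∘_) (trans Σc₁-∘ˡ (trans (cong (_∘ Σc₁ g id) Σc₁-∘ˡ) assoc)) ⟩
    χ ∘ Σc₁ mT id ∘ Σc₁ (T₁ y) id ∘ Σc₁ g id     ≡⟨ sym assoc ⟩
    (χ ∘ Σc₁ mT id) ∘ Σc₁ (T₁ y) id ∘ Σc₁ g id   ≡⟨ cong (_∘ Σc₁ (T₁ y) id ∘ Σc₁ g id) χ-m ⟩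
    (mT ∘ T₁ χ ∘ χ) ∘ Σc₁ (T₁ y) id ∘ Σc₁ g id   ≡⟨ trans assoc (cong (mT ∘_) (trans assoc (cong (T₁ χ ∘_) (sym assoc)))) ⟩
    mT ∘ T₁ χ ∘ (χ ∘ Σc₁ (T₁ y) id) ∘ Σc₁ g id   ≡⟨ cong (λ h → mT ∘ T₁ χ ∘ h ∘ Σc₁ g id) (sym (χ-natural y id)) ⟩
    mT ∘ T₁ χ ∘ (T₁ (Σc₁ y id) ∘ χ) ∘ Σc₁ g id   ≡⟨ cong (mT ∘_) (trans (cong (T₁ χ ∘_) assoc) (sym assoc)) ⟩
    mT ∘ (T₁ χ ∘ T₁ (Σc₁ y id)) ∘ χ ∘ Σc₁ g id   ≡⟨ cong (λ h → mT ∘ h ∘ χ ∘ Σc₁ g id) (sym T-∘) ⟩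
    mT ∘ T₁ (χ ∘ Σc₁ y id) ∘ χ ∘ Σc₁ g id        ≡⟨ sym assoc ⟩
    (χ ∘ Σc₁ y id) ♯ ∘ χ ∘ Σc₁ g id              ∎

module Lemma5p1 {o ℓ r} (C : DistributiveCategory o ℓ)
                (Σv : Theory.Endofunctor C) (Σc : Theory.Bifunctor C)
                (Fr : Theory.WithSig.FreeAlgebras C Σv Σc)
                (T : Theory.StrongMonad C) (D : Theory.MixedBifunctor C)
                (Θd : Theory.WithSig.ThetaDecomposition C Σv Σc)
                (ω : Theory.OmegaContinuous C T r)
                (L : Theory.WithSig.WithFree.SeparatedLaw C Σv Σc Fr T D) where
  open DistributiveCategory C
  open Theory C
  open StrongMonad T
  open OmegaContinuous ω
  open WithSig Σv Σc
  open FreeAlgebras Fr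
  open WithFree Fr T D
  open SeparatedLaw L
  open WithLaw L
  open ThetaDecomposition Θd
  open DistributiveCategoryProperties C
  open StrongMonadProperties C T
  open OmegaContinuity C T ω
  open SignatureProperties C Σv Σc
  open InitialAlgebraProperties C Σv Σc Fr T D
  open DistributiveLawProperties C Σv Σc Fr T D L
  open ≡-Reasoning

  Sc-split : Hom Sc (Σc₀ Sv μΣ ⊕ Θ₀ Sv Sc μΣ)
  Sc-split = split ∘ Σc₁ ι⁻¹ id

  Sc-join : Hom (Σc₀ Sv μΣ ⊕ Θ₀ Sv Sc μΣ) Sc
  Sc-join = [ Σc₁ ιv id , Σc₁ ι id ∘ θ ]

  Sc-join∘Sc-split : Sc-join ∘ Sc-split ≡ id
  Sc-join∘Sc-split = begin
    [ Σc₁ (ι ∘ inl) id , Σc₁ ι id ∘ θ ] ∘ Sc-split            ≡⟨ cong (λ h → [ h , Σc₁ ι id ∘ θ ] ∘ Sc-split) Σc₁-∘ˡ ⟩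
    [ Σc₁ ι id ∘ Σc₁ inl id , Σc₁ ι id ∘ θ ] ∘ Sc-split       ≡⟨ cong (_∘ Sc-split) (sym ∘-[]) ⟩
    (Σc₁ ι id ∘ [ Σc₁ inl id , θ ]) ∘ split ∘ Σc₁ ι⁻¹ id      ≡⟨ trans assoc (cong (Σc₁ ι id ∘_) (sym assoc)) ⟩
    Σc₁ ι id ∘ ([ Σc₁ inl id , θ ] ∘ split) ∘ Σc₁ ι⁻¹ id      ≡⟨ cong (λ h → Σc₁ ι id ∘ h ∘ Σc₁ ι⁻¹ id) split-inverseˡ ⟩
    Σc₁ ι id ∘ id ∘ Σc₁ ι⁻¹ id                                ≡⟨ cong (Σc₁ ι id ∘_) identityˡ ⟩
    Σc₁ ι id ∘ Σc₁ ι⁻¹ id                                     ≡⟨ sym Σc₁-∘ˡ ⟩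
    Σc₁ (ι ∘ ι⁻¹) id                                          ≡⟨ cong (λ h → Σc₁ h id) ι∘ι⁻¹ ⟩
    Σc₁ id id                                                 ≡⟨ Bifunctor.F-id Σc ⟩
    id                                                        ∎

  ⊑-on-Sc : ∀ {Y} {f g : Hom Sc (T₀ Y)} →
            f ∘ Σc₁ ιv id ⊑ g ∘ Σc₁ ιv id → f ∘ Σc₁ ι id ∘ θ ⊑ g ∘ Σc₁ ι id ∘ θ → f ⊑ g
  ⊑-on-Sc on-inl on-θ =
    ⊑-reflect-retraction Sc-join Sc-split Sc-join∘Sc-split (subst₂ _⊑_ (sym ∘-[]) (sym ∘-[]) ([]-monotone on-inl on-θ))

  ⟨ι,γ⟩∘inl : ∀ {γc : Hom Sc (T₀ μΣ)} → ⟨ ι , γv ⊕₁ γc ⟩ ∘ inl ≡ (id ⊗₁ inl) ∘ ⟨ ιv , γv ⟩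
  ⟨ι,γ⟩∘inl = trans ⟨⟩∘ (trans (cong ⟨ ιv ,_⟩ []-inl) ⟨id,⟩∘)

  ⟨ι,γ⟩-split : ∀ {γc : Hom Sc (T₀ μΣ)} →
                ⟨ ι , γv ⊕₁ γc ⟩ ≡ [ id ⊗₁ inl , id ⊗₁ inr ] ∘ (⟨ ιv , γv ⟩ ⊕₁ ⟨ ιc , γc ⟩)
  ⟨ι,γ⟩-split = trans ([]-unique _ ⟨ι,γ⟩∘inl (trans ⟨⟩∘ (trans (cong ⟨ ιc ,_⟩ []-inr) ⟨id,⟩∘))) (sym []∘⊕₁)

  -- γv is pure, so the strength contributes nothing.
  T₁fst∘τ∘⟨ιv,γv⟩ : (T₁ fst ∘ τ) ∘ ⟨ ιv , γv ⟩ ≡ ηT ∘ ιv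
  T₁fst∘τ∘⟨ιv,γv⟩ = begin
    (T₁ fst ∘ τ) ∘ ⟨ ιv , ηT ∘ g ⟩           ≡⟨ cong ((T₁ fst ∘ τ) ∘_) ⟨id,⟩∘ ⟩
    (T₁ fst ∘ τ) ∘ (id ⊗₁ ηT) ∘ ⟨ ιv , g ⟩   ≡⟨ trans assoc (cong (T₁ fst ∘_) (sym assoc)) ⟩
    T₁ fst ∘ (τ ∘ (id ⊗₁ ηT)) ∘ ⟨ ιv , g ⟩   ≡⟨ cong (λ h → T₁ fst ∘ h ∘ ⟨ ιv , g ⟩) τ-η ⟩
    T₁ fst ∘ ηT ∘ ⟨ ιv , g ⟩                 ≡⟨ sym assoc ⟩
    (T₁ fst ∘ ηT) ∘ ⟨ ιv , g ⟩               ≡⟨ cong (_∘ ⟨ ιv , g ⟩) (ηT-natural fst) ⟩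
    (ηT ∘ fst) ∘ ⟨ ιv , g ⟩                  ≡⟨ trans assoc (cong (ηT ∘_) fst-⟨⟩) ⟩
    ηT ∘ ιv                                  ∎
    where g = D₁ id μᶠ ∘ ρv {μΣ}

  module Proof (strongly-separated : StronglySeparated Θd) (χ-cont : χ-ωContinuous ω)
               (γc : Hom Sc (T₀ μΣ)) (γc-eq : IsGammaC γc)
               (β : Hom Sc (T₀ Sv)) (β-lfp : IsLeastFixpoint _⊑_ (Φ γc) β) where

    β̂ : Hom μΣ (T₀ Sv)
    β̂ = βhat β

    -- One operational step on a term split by ι⁻¹; variables are stuck.
    step : Hom (Sv ⊕ Sc) (T₀ μΣ)
    step = [ ηT ∘ ιv , γc ]

    tagged-step : Hom (Sv ⊕ Sc) (T₀ (μΣ ⊕ μΣ))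
    tagged-step = [ T₁ inl ∘ ηT ∘ ιv , T₁ inr ∘ γc ]

    T₁∇∘tagged-step : T₁ ∇ ∘ tagged-step ≡ step
    T₁∇∘tagged-step = trans ∘-[] (cong₂ [_,_] (T₁-retract []-inl) (T₁-retract []-inr))

    β-unfold : ∀ {A} (h : Hom A Sc) → β ∘ h ≡ β̂ ♯ ∘ γc ∘ h
    β-unfold h = begin
      β ∘ h                                  ≡⟨ cong (_∘ h) (sym (proj₁ β-lfp)) ⟩
      ([ ηT , β ] ♯ ∘ T₁ ι⁻¹ ∘ γc) ∘ h       ≡⟨ cong (_∘ h) (trans (sym assoc) (cong (_∘ γc) ♯∘T₁)) ⟩
      (β̂ ♯ ∘ γc) ∘ h                         ≡⟨ assoc ⟩
      β̂ ♯ ∘ γc ∘ h                           ∎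

    β∘Σc₁-ιv : β ∘ Σc₁ ιv id ≡ β̂ ♯ ∘ T₁ ∇♯ ∘ ρcv ∘ Σc₁ ⟨ ιv , γv ⟩ id
    β∘Σc₁-ιv = begin
      β ∘ Σc₁ ιv id                                                 ≡⟨ β-unfold _ ⟩
      β̂ ♯ ∘ γc ∘ Σc₁ (ι ∘ inl) id                                   ≡⟨ cong (β̂ ♯ ∘_) (trans (cong (γc ∘_) Σc₁-∘ˡ) (sym assoc)) ⟩
      β̂ ♯ ∘ (γc ∘ Σc₁ ι id) ∘ Σc₁ inl id                            ≡⟨ cong (λ h → β̂ ♯ ∘ h ∘ Σc₁ inl id) γc-eq ⟩
      β̂ ♯ ∘ (T₁ ∇♯ ∘ ρc ∘ Σc₁ ⟨ ι , γv ⊕₁ γc ⟩ id) ∘ Σc₁ inl id      ≡⟨ cong (β̂ ♯ ∘_) (trans assoc (cong (T₁ ∇♯ ∘_) (trans assoc (cong (ρc ∘_) (sym Σc₁-∘ˡ))))) ⟩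
      β̂ ♯ ∘ T₁ ∇♯ ∘ ρc ∘ Σc₁ (⟨ ι , γv ⊕₁ γc ⟩ ∘ inl) id            ≡⟨ cong (λ h → β̂ ♯ ∘ T₁ ∇♯ ∘ ρc ∘ Σc₁ h id) ⟨ι,γ⟩∘inl ⟩
      β̂ ♯ ∘ T₁ ∇♯ ∘ ρc ∘ Σc₁ ((id ⊗₁ inl) ∘ ⟨ ιv , γv ⟩) id         ≡⟨ cong (λ h → β̂ ♯ ∘ T₁ ∇♯ ∘ h) (trans (cong (ρc ∘_) Σc₁-∘ˡ) (sym assoc)) ⟩
      β̂ ♯ ∘ T₁ ∇♯ ∘ ρcv ∘ Σc₁ ⟨ ιv , γv ⟩ id                        ∎

    -- Strong separation: on the Θ-summand, ρc only rearranges the already computed steps.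
    ρc-on-θ : ρc ∘ Σc₁ ⟨ ι , γv ⊕₁ γc ⟩ id ∘ θ
              ≡ T₁ (ιc ∘ Σc₁ ηΣ ηΣ) ∘ χ ∘ Σc₁ tagged-step (inl {B = μΣ}) ∘ θ
    ρc-on-θ = begin
      ρc ∘ Σc₁ ⟨ ι , γv ⊕₁ γc ⟩ id ∘ θ                ≡⟨ cong (λ h → ρc ∘ Σc₁ h id ∘ θ) ⟨ι,γ⟩-split ⟩
      ρc ∘ Σc₁ (δ ∘ (a ⊕₁ b)) id ∘ θ                  ≡⟨ cong (λ h → ρc ∘ h ∘ θ) Σc₁-∘ˡ ⟩
      ρc ∘ (Σc₁ δ id ∘ Σc₁ (a ⊕₁ b) id) ∘ θ           ≡⟨ cong (ρc ∘_) (trans assoc (cong (Σc₁ δ id ∘_) (θ-natural a b id))) ⟩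
      ρc ∘ Σc₁ δ id ∘ θ ∘ Θ₁                          ≡⟨ trans (cong (ρc ∘_) (sym assoc)) (sym assoc) ⟩
      (ρc ∘ Σc₁ δ id ∘ θ) ∘ Θ₁                        ≡⟨ cong (_∘ Θ₁) strongly-separated ⟩
      (T₁ h ∘ χ ∘ Σc₁ k inl ∘ θ) ∘ Θ₁                 ≡⟨ trans assoc (cong (T₁ h ∘_) (trans assoc (cong (χ ∘_) assoc))) ⟩
      T₁ h ∘ χ ∘ Σc₁ k inl ∘ θ ∘ Θ₁                   ≡⟨ cong (λ z → T₁ h ∘ χ ∘ Σc₁ k inl ∘ z) (sym (θ-natural a b id)) ⟩
      T₁ h ∘ χ ∘ Σc₁ k inl ∘ Σc₁ (a ⊕₁ b) id ∘ θ      ≡⟨ cong (λ z → T₁ h ∘ χ ∘ z) (trans (sym assoc) (cong (_∘ θ) (sym (Bifunctor.F-∘ Σc)))) ⟩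
      T₁ h ∘ χ ∘ Σc₁ (k ∘ (a ⊕₁ b)) (inl ∘ id) ∘ θ    ≡⟨ cong (λ z → T₁ h ∘ χ ∘ z ∘ θ) (cong₂ Σc₁ k∘a⊕b identityʳ) ⟩
      T₁ h ∘ χ ∘ Σc₁ tagged-step (inl {B = μΣ}) ∘ θ ∎
      where
      h = ιc ∘ Σc₁ ηΣ ηΣ
      a = ⟨ ιv , γv ⟩
      b = ⟨ ιc , γc ⟩
      δ = [ id ⊗₁ inl , id ⊗₁ inr ]
      k = (T₁ fst ∘ τ) ⊞ snd
      Θ₁ = Trifunctor.F₁ Θ a b id
      k∘a⊕b : k ∘ (a ⊕₁ b) ≡ tagged-step
      k∘a⊕b = trans []∘⊕₁ (cong₂ [_,_] (trans assoc (cong (T₁ inl ∘_) T₁fst∘τ∘⟨ιv,γv⟩))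
                                        (trans assoc (cong (T₁ inr ∘_) snd-⟨⟩)))

    T₁Σc₁∇-untags : T₁ (Σc₁ ∇ ∇) ∘ χ ∘ Σc₁ tagged-step (inl {B = μΣ}) ∘ θ ≡ χ ∘ Σc₁ step id ∘ θ
    T₁Σc₁∇-untags = begin
      T₁ (Σc₁ ∇ ∇) ∘ χ ∘ Σc₁ k inl ∘ θ          ≡⟨ trans (sym assoc) (cong (_∘ Σc₁ k inl ∘ θ) (χ-natural ∇ ∇)) ⟩
      (χ ∘ Σc₁ (T₁ ∇) ∇) ∘ Σc₁ k inl ∘ θ        ≡⟨ trans assoc (cong (χ ∘_) (sym assoc)) ⟩
      χ ∘ (Σc₁ (T₁ ∇) ∇ ∘ Σc₁ k inl) ∘ θ        ≡⟨ cong (λ z → χ ∘ z ∘ θ) (sym (Bifunctor.F-∘ Σc)) ⟩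
      χ ∘ Σc₁ (T₁ ∇ ∘ k) (∇ ∘ inl) ∘ θ          ≡⟨ cong (λ z → χ ∘ z ∘ θ) (cong₂ Σc₁ T₁∇∘tagged-step []-inl) ⟩
      χ ∘ Σc₁ step id ∘ θ                       ∎
      where k = tagged-step

    β∘Σc₁-ι∘θ : β ∘ Σc₁ ι id ∘ θ ≡ β ♯ ∘ χ ∘ Σc₁ step id ∘ θ
    β∘Σc₁-ι∘θ = begin
      β ∘ Σc₁ ι id ∘ θ                                  ≡⟨ β-unfold _ ⟩
      β̂ ♯ ∘ γc ∘ Σc₁ ι id ∘ θ                           ≡⟨ cong (β̂ ♯ ∘_) (trans (sym assoc) (cong (_∘ θ) γc-eq)) ⟩
      β̂ ♯ ∘ (T₁ ∇♯ ∘ ρc ∘ Σc₁ ⟨ ι , γv ⊕₁ γc ⟩ id) ∘ θ   ≡⟨ cong (β̂ ♯ ∘_) (trans assoc (cong (T₁ ∇♯ ∘_) assoc)) ⟩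
      β̂ ♯ ∘ T₁ ∇♯ ∘ ρc ∘ Σc₁ ⟨ ι , γv ⊕₁ γc ⟩ id ∘ θ     ≡⟨ cong (λ z → β̂ ♯ ∘ T₁ ∇♯ ∘ z) ρc-on-θ ⟩
      β̂ ♯ ∘ T₁ ∇♯ ∘ T₁ (ιc ∘ Σc₁ ηΣ ηΣ) ∘ W             ≡⟨ cong (β̂ ♯ ∘_) (trans (sym assoc) (cong (_∘ W) (sym T-∘))) ⟩
      β̂ ♯ ∘ T₁ (∇♯ ∘ ιc ∘ Σc₁ ηΣ ηΣ) ∘ W                ≡⟨ trans (sym assoc) (cong (_∘ W) ♯∘T₁) ⟩
      (β̂ ∘ ∇♯ ∘ ιc ∘ Σc₁ ηΣ ηΣ) ♯ ∘ W                   ≡⟨ cong (λ z → (β̂ ∘ z) ♯ ∘ W) ∇♯∘ιc∘ηΣ ⟩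
      (β̂ ∘ ι ∘ inr ∘ Σc₁ ∇ ∇) ♯ ∘ W                     ≡⟨ cong (λ z → z ♯ ∘ W) (trans ∘ι⁻¹∘ι (trans (sym assoc) (cong (_∘ Σc₁ ∇ ∇) []-inr))) ⟩
      (β ∘ Σc₁ ∇ ∇) ♯ ∘ W                               ≡⟨ cong (_∘ W) (sym ♯∘T₁) ⟩
      (β ♯ ∘ T₁ (Σc₁ ∇ ∇)) ∘ W                          ≡⟨ trans assoc (cong (β ♯ ∘_) T₁Σc₁∇-untags) ⟩
      β ♯ ∘ χ ∘ Σc₁ step id ∘ θ                         ∎
      where W = χ ∘ Σc₁ tagged-step (inl {B = μΣ}) ∘ θ

    χ∘Σc₁-continuous : ∀ {A X Y} → Continuous {A} {X} (λ x → χ {X} {Y} ∘ Σc₁ x id)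
    χ∘Σc₁-continuous = continuous χ-cont

    Ψ : Hom μΣ (T₀ Sv) → Hom Sc (T₀ Sv)
    Ψ x = β ♯ ∘ χ ∘ Σc₁ (T₁ ιv ∘ x) id

    Ψθ : Hom (Sv ⊕ Sc) (T₀ μΣ) → Hom (Θ₀ Sv Sc μΣ) (T₀ Sv)
    Ψθ y = β ♯ ∘ χ ∘ Σc₁ y id ∘ θ

    Ψθ-monotone : ∀ {y y'} → y ⊑ y' → Ψθ y ⊑ Ψθ y'
    Ψθ-monotone = continuous⇒monotone
      (continuous-resp (λ y → cong (β ♯ ∘_) (sym assoc))
        (continuous-∘ (♯∘-continuous β) (continuous-∘ (∘-continuous θ) χ∘Σc₁-continuous)))

    Ψ∘βhat-continuous : Continuous (λ x → Ψ (βhat x))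
    Ψ∘βhat-continuous =
      continuous-∘ (continuous-∘ (♯∘-continuous β) (continuous-∘ χ∘Σc₁-continuous (T₁∘-continuous ιv)))
                   (continuous-∘ (∘-continuous ι⁻¹) [ ηT ,-]-continuous)

    lhs≡Ψβ̂ : β̂ ♯ ∘ T₁ ∇♯ ∘ ρcv {μΣ} {μΣ} ♯ ∘ χ ∘ Σc₁ (T₁ ⟨ ιv , γv ⟩ ∘ β̂) id ≡ Ψ β̂
    lhs≡Ψβ̂ = begin
      β̂ ♯ ∘ T₁ ∇♯ ∘ ρcv ♯ ∘ χ ∘ Σc₁ (T₁ ⟨ ιv , γv ⟩ ∘ β̂) id   ≡⟨ cong (λ z → β̂ ♯ ∘ T₁ ∇♯ ∘ ρcv ♯ ∘ z) χ∘Σc₁-T₁ ⟩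
      β̂ ♯ ∘ T₁ ∇♯ ∘ ρcv ♯ ∘ T₁ (Σc₁ ⟨ ιv , γv ⟩ id) ∘ Y       ≡⟨ cong (λ z → β̂ ♯ ∘ T₁ ∇♯ ∘ z) (trans (sym assoc) (cong (_∘ Y) ♯∘T₁)) ⟩
      β̂ ♯ ∘ T₁ ∇♯ ∘ (ρcv ∘ Σc₁ ⟨ ιv , γv ⟩ id) ♯ ∘ Y          ≡⟨ cong (β̂ ♯ ∘_) (trans (sym assoc) (cong (_∘ Y) T₁∘♯)) ⟩
      β̂ ♯ ∘ (T₁ ∇♯ ∘ ρcv ∘ Σc₁ ⟨ ιv , γv ⟩ id) ♯ ∘ Y          ≡⟨ trans (sym assoc) (cong (_∘ Y) ♯∘♯) ⟩
      (β̂ ♯ ∘ T₁ ∇♯ ∘ ρcv ∘ Σc₁ ⟨ ιv , γv ⟩ id) ♯ ∘ Y          ≡⟨ cong (λ z → z ♯ ∘ Y) (sym β∘Σc₁-ιv) ⟩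
      (β ∘ Σc₁ ιv id) ♯ ∘ Y                                   ≡⟨ trans (cong (_∘ Y) (sym ♯∘T₁)) assoc ⟩
      β ♯ ∘ T₁ (Σc₁ ιv id) ∘ Y                                ≡⟨ cong (β ♯ ∘_) (sym χ∘Σc₁-T₁) ⟩
      Ψ β̂                                                    ∎
      where Y = χ ∘ Σc₁ β̂ id

    Ψ∘Σc₁ : ∀ {A} (x : Hom μΣ (T₀ Sv)) (h : Hom A μΣ) → Ψ x ∘ Σc₁ h id ≡ β ♯ ∘ χ ∘ Σc₁ (T₁ ιv ∘ x ∘ h) id
    Ψ∘Σc₁ x h = trans assoc (cong (β ♯ ∘_) (trans assoc (cong (χ ∘_) (trans (sym Σc₁-∘ˡ) (cong (λ z → Σc₁ z id) assoc)))))

    Ψ-on-inl : ∀ x → Ψ (βhat x) ∘ Σc₁ ιv id ≡ β ∘ Σc₁ ιv id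
    Ψ-on-inl x = begin
      Ψ (βhat x) ∘ Σc₁ ιv id                           ≡⟨ Ψ∘Σc₁ (βhat x) ιv ⟩
      β ♯ ∘ χ ∘ Σc₁ (T₁ ιv ∘ βhat x ∘ ι ∘ inl) id      ≡⟨ cong (λ z → β ♯ ∘ χ ∘ Σc₁ (T₁ ιv ∘ z) id) (trans ∘ι⁻¹∘ι []-inl) ⟩
      β ♯ ∘ χ ∘ Σc₁ (T₁ ιv ∘ ηT) id                    ≡⟨ cong (λ z → β ♯ ∘ χ ∘ Σc₁ z id) (ηT-natural ιv) ⟩
      β ♯ ∘ χ ∘ Σc₁ (ηT ∘ ιv) id                       ≡⟨ cong (β ♯ ∘_) χ∘Σc₁-ηT ⟩
      β ♯ ∘ ηT ∘ Σc₁ ιv id                             ≡⟨ ♯∘ηT∘ ⟩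
      β ∘ Σc₁ ιv id                                    ∎

    Ψ-on-θ : ∀ x → Ψ (βhat x) ∘ Σc₁ ι id ∘ θ ≡ Ψθ (T₁ ιv ∘ [ ηT , x ])
    Ψ-on-θ x = trans (sym assoc) (trans (cong (_∘ θ) (Ψ∘Σc₁ (βhat x) ι))
                 (trans assoc (cong (β ♯ ∘_) (trans assoc (cong (λ z → χ ∘ Σc₁ (T₁ ιv ∘ z) id ∘ θ) ∘ι⁻¹∘ι-id)))))
      where
      ∘ι⁻¹∘ι-id : βhat x ∘ ι ≡ [ ηT , x ]
      ∘ι⁻¹∘ι-id = trans assoc (trans (cong ([ ηT , x ] ∘_) ι⁻¹∘ι) identityʳ)

    T₁ιv∘[ηT,Φ] : ∀ x → T₁ ιv ∘ [ ηT , Φ γc x ] ≡ (T₁ ιv ∘ βhat x) ♯ ∘ step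
    T₁ιv∘[ηT,Φ] x = trans ∘-[] (sym (trans ∘-[] (cong₂ [_,_] on-variables on-γc)))
      where
      on-variables : (T₁ ιv ∘ βhat x) ♯ ∘ ηT ∘ ιv ≡ T₁ ιv ∘ ηT
      on-variables = trans ♯∘ηT∘ (trans assoc (cong (T₁ ιv ∘_) (trans ∘ι⁻¹∘ι []-inl)))
      on-γc : (T₁ ιv ∘ βhat x) ♯ ∘ γc ≡ T₁ ιv ∘ Φ γc x
      on-γc = trans (cong (_∘ γc) (sym T₁∘♯))
                    (trans assoc (cong (T₁ ιv ∘_) (sym (trans (sym assoc) (cong (_∘ γc) ♯∘T₁)))))

    Φ-continuous : Continuous (Φ γc)
    Φ-continuous = continuous-∘ (-♯∘-continuous (T₁ ι⁻¹ ∘ γc)) [ ηT ,-]-continuous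

    Ψ-approximant⊑β : ∀ n → Ψ (βhat (fold ⊥ (Φ γc) n)) ⊑ β
    Ψθ-approximant⊑Ψθ-step : ∀ n → Ψθ (T₁ ιv ∘ [ ηT , fold ⊥ (Φ γc) n ]) ⊑ Ψθ step

    Ψ-approximant⊑β n = ⊑-on-Sc (≡⇒⊑ (Ψ-on-inl _))
      (subst₂ _⊑_ (sym (Ψ-on-θ _)) (sym β∘Σc₁-ι∘θ) (Ψθ-approximant⊑Ψθ-step n))

    Ψθ-approximant⊑Ψθ-step zero = Ψθ-monotone (subst (_⊑ step) (sym T₁ιv∘[ηT,⊥]) ([]-monotone ⊑-refl (⊥-least _)))
      where
      T₁ιv∘[ηT,⊥] : T₁ ιv ∘ [ ηT , ⊥ ] ≡ [ ηT ∘ ιv , ⊥ ]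
      T₁ιv∘[ηT,⊥] = trans ∘-[] (cong₂ [_,_] (ηT-natural ιv) (trans (cong (_∘ ⊥) T₁-as-♯) (kleisli-⊥ _)))
    Ψθ-approximant⊑Ψθ-step (suc n) =
      subst₂ _⊑_ (sym unfold) refl (continuous⇒monotone (-♯∘-continuous (χ ∘ Σc₁ step id ∘ θ)) (Ψ-approximant⊑β n))
      where
      bₙ = fold ⊥ (Φ γc) n
      y = T₁ ιv ∘ βhat bₙ
      unfold : Ψθ (T₁ ιv ∘ [ ηT , Φ γc bₙ ]) ≡ Ψ (βhat bₙ) ♯ ∘ χ ∘ Σc₁ step id ∘ θ
      unfold = begin
        β ♯ ∘ χ ∘ Σc₁ (T₁ ιv ∘ [ ηT , Φ γc bₙ ]) id ∘ θ   ≡⟨ cong (λ z → β ♯ ∘ χ ∘ Σc₁ z id ∘ θ) (T₁ιv∘[ηT,Φ] bₙ) ⟩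
        β ♯ ∘ χ ∘ Σc₁ (y ♯ ∘ step) id ∘ θ                ≡⟨ cong (β ♯ ∘_) (trans (sym assoc) (cong (_∘ θ) χ∘Σc₁-♯)) ⟩
        β ♯ ∘ ((χ ∘ Σc₁ y id) ♯ ∘ χ ∘ Σc₁ step id) ∘ θ   ≡⟨ cong (β ♯ ∘_) assoc ⟩
        β ♯ ∘ (χ ∘ Σc₁ y id) ♯ ∘ (χ ∘ Σc₁ step id) ∘ θ   ≡⟨ trans (sym assoc) (cong (_∘ ((χ ∘ Σc₁ step id) ∘ θ)) ♯∘♯) ⟩
        Ψ (βhat bₙ) ♯ ∘ (χ ∘ Σc₁ step id) ∘ θ           ≡⟨ cong (Ψ (βhat bₙ) ♯ ∘_) assoc ⟩
        Ψ (βhat bₙ) ♯ ∘ χ ∘ Σc₁ step id ∘ θ             ∎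

lemma5p1 : ∀ {o ℓ r : Level}
  (C : DistributiveCategory o ℓ)
  (Σv : Theory.Endofunctor C)
  (Σc : Theory.Bifunctor C)
  (Fr : Theory.WithSig.FreeAlgebras C Σv Σc)
  (T : Theory.StrongMonad C)
  (D : Theory.MixedBifunctor C)
  (Θd : Theory.WithSig.ThetaDecomposition C Σv Σc)
  (ω : Theory.OmegaContinuous C T r)
  (L : Theory.WithSig.WithFree.SeparatedLaw C Σv Σc Fr T D) →
  let open DistributiveCategory C
      open Theory C
      open StrongMonad T
      open OmegaContinuous ω
      open WithSig Σv Σc
      open FreeAlgebras Fr
      open WithFree Fr T D
      open SeparatedLaw L
      open WithLaw L
  in StronglySeparated Θd →
     χ-ωContinuous ω →
     (γc : Hom Sc (T₀ μΣ)) → IsGammaC γc →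
     (β : Hom Sc (T₀ Sv)) → IsLeastFixpoint _⊑_ (Φ γc) β →
     (βhat β) ♯ ∘ T₁ ∇♯ ∘ (ρcv {μΣ} {μΣ}) ♯ ∘ χ ∘ Σc₁ (T₁ ⟨ ιv , γv ⟩ ∘ βhat β) id ⊑ β
lemma5p1 C Σv Σc Fr T D Θd ω L strongly-separated χ-cont γc γc-eq β β-lfp =
  subst (_⊑ β) (sym lhs≡Ψβ̂)
    (proj₂ (continuous-preserves-lub Ψ∘βhat-continuous kleene-chain (leastFixpoint-isLub β-lfp))
           β Ψ-approximant⊑β)
  where
  open Theory.OmegaContinuous ω using (_⊑_)
  open OmegaContinuity C T ω using (continuous-preserves-lub; module Kleene)
  open Lemma5p1 C Σv Σc Fr T D Θd ω L
  open Proof strongly-separated χ-cont γc γc-eq β β-lfp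
  open Kleene Φ-continuous
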